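{- For every natural number $n>2$, the star $K_{1,n}$ is not $\mathcal{D}_t$-unique. In particular, the $\mathcal{D}_t$-equivalence class of $K_{1,n}$ contains $K_{1,n}$, the lollipop graph $L(n,1)$, and the graph $L(n,1)-e$ for any edge $e$ of the complete subgraph $K_n$ of $L(n,1)$ that is not adjacent to the pendant edge of $L(n,1)$.
   Context: A set $D\subseteq V(G)$ is a total dominating set of $G$ if every vertex of $G$ is adjacent to some vertex of $D$. The total domination polynomial is $D_t(G,x)=\sum_i d_t(G,i)x^i$, where $d_t(G,i)$ is the number of total dominating sets of $G$ of size $i$. Two graphs are $\mathcal{D}_t$-equivalent if they have the same total domination polynomial; the $\mathcal{D}_t$-equivalence class $[G]$ is the set of graphs $\mathcal{D}_t$-equivalent to $G$, and $G$ is $\mathcal{D}_t$-unique if $[G]=\{G\}$ (up to isomorphism). The lollipop graph $L(n,1)$ is the complete graph $K_n$ together with one extra vertex joined by a single (pendant) edge to one vertex of $K_n$. $L(n,1)-e$ denotes $L(n,1)$ with edge $e$ deleted. -}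

module Defs where

open import Data.Nat using (ℕ; zero; suc; _<_)
open import Data.Bool using (Bool; true; false; _∧_; _∨_; not; if_then_else_)
open import Data.Fin using (Fin; toℕ; fromℕ; _≟_)
open import Data.Fin.Subset using (Subset; ∣_∣; _∈_)
open import Data.Vec using (Vec; []; _∷_; lookup)
open import Data.List using (List; []; _∷_; _++_; map; filterᵇ; length; allFin)
import Data.Bool.ListAction as BL
import Data.List as L
open import Data.Product using (Σ; _×_; _,_; ∃)
open import Function.Bundles using (_⤖_; Bijection)
open import Relation.Binary.PropositionalEquality using (_≡_; refl; cong; cong₂)
open import Data.Bool.Properties using (∨-comm)
open import Relation.Nullary using (¬_; does)
import Data.Nat as ℕ

record Graph : Set where
  field
    order  : ℕ
    adj    : Fin order → Fin order → Bool
    sym    : ∀ u v → adj u v ≡ adj v u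
    irrefl : ∀ v → adj v v ≡ false
open Graph public

_≅_ : Graph → Graph → Set
G ≅ H = Σ (Fin (order G) ⤖ Fin (order H)) λ f →
          ∀ u v → adj G u v ≡ adj H (Bijection.to f u) (Bijection.to f v)

allSubsets : (n : ℕ) → List (Subset n)
allSubsets zero = [] ∷ []
allSubsets (suc n) = map (true ∷_) (allSubsets n) ++ map (false ∷_) (allSubsets n)

isTotalDominating : (G : Graph) → Subset (order G) → Bool
isTotalDominating G D =
  BL.all (λ v → BL.any (λ u → lookup D u ∧ adj G u v) (allFin (order G))) (allFin (order G))

dt : Graph → ℕ → ℕ
dt G i = length (filterᵇ (λ D → isTotalDominating G D ∧ (∣ D ∣ ℕ.≡ᵇ i))
                         (allSubsets (order G)))

-- D_t-equivalence: equal total domination polynomials (equal coefficients)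
_~t_ : Graph → Graph → Set
G ~t H = ∀ i → dt G i ≡ dt H i

DtUnique : Graph → Set
DtUnique G = (H : Graph) → G ~t H → G ≅ H

private
  ≡ᵇ-refl : ∀ a → (a ℕ.≡ᵇ a) ≡ true
  ≡ᵇ-refl zero = refl
  ≡ᵇ-refl (suc a) = ≡ᵇ-refl a

  ≡ᵇ-sym : ∀ a b → (a ℕ.≡ᵇ b) ≡ (b ℕ.≡ᵇ a)
  ≡ᵇ-sym zero zero = refl
  ≡ᵇ-sym zero (suc b) = refl
  ≡ᵇ-sym (suc a) zero = refl
  ≡ᵇ-sym (suc a) (suc b) = ≡ᵇ-sym a b

symClosure : (m : ℕ) → (Fin m → Fin m → Bool) → Graph
symClosure m h = record
  { order = m
  ; adj = λ u v → not (toℕ u ℕ.≡ᵇ toℕ v) ∧ (h u v ∨ h v u)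
  ; sym = λ u v → cong₂ (λ x y → not x ∧ y) (≡ᵇ-sym (toℕ u) (toℕ v)) (∨-comm (h u v) (h v u))
  ; irrefl = λ v → cong (λ x → not x ∧ (h v v ∨ h v v)) (≡ᵇ-refl (toℕ v))
  }

-- The star K_{1,n}: vertex 0 is the centre, vertices 1..n are leaves.
star : ℕ → Graph
star n = symClosure (suc n) (λ u v → toℕ u ℕ.≡ᵇ 0)

-- The lollipop L(n,1): vertices 0..n-1 form K_n, vertex n is the pendant
-- vertex, joined to vertex 0 of K_n.
lollipop : ℕ → Graph
lollipop n = symClosure (suc n) (λ u v →
  ((toℕ u ℕ.<ᵇ n) ∧ (toℕ v ℕ.<ᵇ n)) ∨ ((toℕ u ℕ.≡ᵇ n) ∧ (toℕ v ℕ.≡ᵇ 0)))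

deleteEdge : (G : Graph) → Fin (order G) → Fin (order G) → Graph
deleteEdge G a b = record
  { order = order G
  ; adj = λ u v → adj G u v ∧ not (isE u v ∨ isE v u)
  ; sym = λ u v → cong₂ (λ x y → x ∧ not y) (Graph.sym G u v) (∨-comm (isE u v) (isE v u))
  ; irrefl = λ v → cong (λ x → x ∧ not (isE v v ∨ isE v v)) (irrefl G v)
  }
  where
    isE : Fin (order G) → Fin (order G) → Bool
    isE u v = (toℕ u ℕ.≡ᵇ toℕ a) ∧ (toℕ v ℕ.≡ᵇ toℕ b)

-- In K_{1,n}, in L(n,1), and in L(n,1) - e for an edge e of K_n avoiding the
-- vertex of attachment, vertex 0 is adjacent to every other vertex and is the only
-- neighbour of some pendant vertex. In any such graph a set is totally dominating
-- exactly when it contains vertex 0 together with some other vertex, so all three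
-- graphs have the same total dominating sets and hence the same polynomial.
-- For n ≥ 3 the star has three pairwise non-adjacent leaves, while any three
-- vertices of L(n,1) include two vertices of the clique K_n; so K_{1,n} ≇ L(n,1).
module Submission where

open import Defs
open import Data.Nat using (ℕ; suc; _<_; _≤_)
open import Data.Fin using (Fin; toℕ)
open import Data.Product using (_×_; Σ)
open import Relation.Binary.PropositionalEquality using (_≢_)
open import Relation.Nullary using (¬_)

open import Relation.Nullary using (yes; no)
open import Data.Bool using (Bool; true; false; T; _∧_; _∨_; not)
open import Data.Bool.Properties using (T-∧; T-∨; T-not-≡; ∧-zeroʳ; ∧-identityʳ)
import Data.Bool.ListAction as BL
open import Data.Empty using (⊥-elim)
open import Data.Fin using (zero; suc; fromℕ; _≟_)
open import Data.Fin.Properties using (toℕ-injective; toℕ-fromℕ; toℕ≤pred[n])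
open import Data.Fin.Subset using (Subset; ∣_∣)
open import Data.List using (allFin; filterᵇ; length)
open import Data.List.Properties using (filter-≐)
import Data.List.Relation.Unary.All.Properties as All
import Data.List.Relation.Unary.Any.Properties as Any
open import Data.Nat using (_+_; z≤n; s≤s; _≡ᵇ_; _<ᵇ_)
open import Data.Nat.Properties
  using (≡ᵇ⇒≡; ≡⇒≡ᵇ; <ᵇ⇒<; <⇒<ᵇ; <-irrefl; m≤n⇒m<n∨m≡n)
open import Data.Product using (_,_; proj₁; ∃-syntax)
open import Data.Product.Function.NonDependent.Propositional using (_×-⇔_)
open import Data.Sum using (_⊎_; inj₁; inj₂)
open import Data.Sum.Function.Propositional using (_⊎-⇔_)
open import Data.Unit using (tt)
open import Data.Vec using (lookup)
open import Function using (_∘_)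
open import Function.Bundles using (_⇔_; mk⇔; Equivalence; Bijection)
open import Function.Properties.Equivalence using () renaming (refl to ⇔-refl; trans to ⇔-trans)
open import Function.Construct.Symmetry using (⇔-sym)
open import Relation.Binary.PropositionalEquality
  using (_≡_; refl; trans; cong; cong₂; subst; ≢-sym; module ≡-Reasoning)
import Relation.Binary.PropositionalEquality as ≡

open Equivalence using (to; from)

T-not : ∀ {b} → T (not b) ⇔ (¬ T b)
T-not {false} = mk⇔ (λ _ ()) (λ _ → tt)
T-not {true}  = mk⇔ (λ ()) (λ ¬t → ¬t tt)

T-≢ᵇ : ∀ {k} {u v : Fin k} → T (not (toℕ u ≡ᵇ toℕ v)) ⇔ (u ≢ v)
T-≢ᵇ {u = u} {v} = ⇔-trans T-not
  (mk⇔ (λ ¬t u≡v → ¬t (≡⇒≡ᵇ (toℕ u) (toℕ v) (cong toℕ u≡v)))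
       (λ u≢v t → u≢v (toℕ-injective (≡ᵇ⇒≡ (toℕ u) (toℕ v) t))))

≢⇒≡ᵇ≡false : ∀ {k} {u v : Fin k} → u ≢ v → (toℕ u ≡ᵇ toℕ v) ≡ false
≢⇒≡ᵇ≡false = to T-not-≡ ∘ from T-≢ᵇ

all-allFin⇔ : ∀ {k} (p : Fin k → Bool) → T (BL.all p (allFin k)) ⇔ (∀ i → T (p i))
all-allFin⇔ p = mk⇔ (All.tabulate⁻ ∘ All.all⁺ p _) (All.all⁻ p ∘ All.tabulate⁺)

any-allFin⇔ : ∀ {k} (p : Fin k → Bool) → T (BL.any p (allFin k)) ⇔ (∃[ i ] T (p i))
any-allFin⇔ p = mk⇔ (Any.tabulate⁻ ∘ Any.any⁻ p _) (λ (i , pᵢ) → Any.any⁺ p (Any.tabulate⁺ i pᵢ))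

countOfSize : ∀ {k} → (Subset k → Bool) → ℕ → ℕ
countOfSize {k} P i = length (filterᵇ (λ D → P D ∧ (∣ D ∣ ≡ᵇ i)) (allSubsets k))

countOfSize-cong : ∀ {k} {P Q : Subset k → Bool} →
  (∀ D → T (P D) ⇔ T (Q D)) → ∀ i → countOfSize P i ≡ countOfSize Q i
countOfSize-cong {k} P⇔Q i =
  cong length (filter-≐ _ _ (transfer P⇔Q , transfer (⇔-sym ∘ P⇔Q)) (allSubsets k))
  where
  transfer : ∀ {P Q : Subset k → Bool} → (∀ D → T (P D) ⇔ T (Q D)) →
    ∀ {D} → T (P D ∧ (∣ D ∣ ≡ᵇ i)) → T (Q D ∧ (∣ D ∣ ≡ᵇ i))
  transfer P⇔Q {D} t =
    let (p , s) = to T-∧ t in from T-∧ (to (P⇔Q D) p , s)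

TotallyDominates : (G : Graph) → Subset (order G) → Set
TotallyDominates G D = ∀ v → ∃[ u ] T (lookup D u) × T (adj G u v)

isTotalDominating⇔ : ∀ G {D} → T (isTotalDominating G D) ⇔ TotallyDominates G D
isTotalDominating⇔ G {D} = mk⇔
  (λ t v → let (u , d) = to (any-allFin⇔ _) (to (all-allFin⇔ _) t v) in u , to T-∧ d)
  (λ dom → from (all-allFin⇔ _) λ v →
    let (u , du , a) = dom v in from (any-allFin⇔ _) (u , from T-∧ (du , a)))

record PendantHub (G : Graph) (h : Fin (order G)) : Set where
  field
    hub-adj      : ∀ {v} → v ≢ h → T (adj G h v)
    pendant      : Fin (order G)
    pendant-only : ∀ {u} → T (adj G u pendant) → u ≡ h
open PendantHub

HubAndAnother : ∀ {k} → Fin k → Subset k → Set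
HubAndAnother h D = T (lookup D h) × ∃[ u ] u ≢ h × T (lookup D u)

-- The pendant forces the hub into D; the hub, having no loop, needs a second vertex of D.
totallyDominates⇔ : ∀ {G h} → PendantHub G h → ∀ D → TotallyDominates G D ⇔ HubAndAnother h D
totallyDominates⇔ {G} {h} P D = mk⇔ hubAndAnother dominates
  where
  hubAndAnother : TotallyDominates G D → HubAndAnother h D
  hubAndAnother dom =
    let (u , du , u~p) = dom (pendant P)
        (w , dw , w~h) = dom h
    in subst (T ∘ lookup D) (pendant-only P u~p) du ,
       w , (λ w≡h → subst T (irrefl G h) (subst (λ x → T (adj G x h)) w≡h w~h)) , dw

  dominates : HubAndAnother h D → TotallyDominates G D
  dominates (dh , w , w≢h , dw) v with v ≟ h
  ... | yes refl = w , dw , subst T (Graph.sym G h w) (hub-adj P w≢h)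
  ... | no v≢h   = h , dh , hub-adj P v≢h

isTotalDominating⇔HubAndAnother : ∀ {G h} → PendantHub G h → ∀ D →
  T (isTotalDominating G D) ⇔ HubAndAnother h D
isTotalDominating⇔HubAndAnother {G} P D =
  ⇔-trans (isTotalDominating⇔ G {D}) (totallyDominates⇔ P D)

adj-symClosure : ∀ {m} (h : Fin m → Fin m → Bool) u v →
  T (adj (symClosure m h) u v) ⇔ (u ≢ v × (T (h u v) ⊎ T (h v u)))
adj-symClosure h u v = ⇔-trans T-∧ (T-≢ᵇ ×-⇔ T-∨)

adj-star : ∀ {n} (u v : Fin (suc n)) →
  T (adj (star n) u v) ⇔ (u ≢ v × (T (toℕ u ≡ᵇ 0) ⊎ T (toℕ v ≡ᵇ 0)))
adj-star = adj-symClosure _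

star-leaves-nonadjacent : ∀ {n} (i j : Fin n) → ¬ T (adj (star n) (suc i) (suc j))
star-leaves-nonadjacent i j a with to (adj-star (suc i) (suc j)) a
... | _ , inj₁ ()
... | _ , inj₂ ()

star-pendantHub : ∀ n → PendantHub (star (suc n)) zero
star-pendantHub n .hub-adj {zero} 0≢0 = ⊥-elim (0≢0 refl)
star-pendantHub n .hub-adj {suc w} _ = from (adj-star zero (suc w)) ((λ ()) , inj₁ tt)
star-pendantHub n .pendant = suc zero
star-pendantHub n .pendant-only {zero} _ = refl
star-pendantHub n .pendant-only {suc u} a = ⊥-elim (star-leaves-nonadjacent u zero a)

LollipopEdge : ℕ → ℕ → ℕ → Set
LollipopEdge n x y = (x < n × y < n) ⊎ (x ≡ n × y ≡ 0)

lollipopEdge⇔ : ∀ n x y →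
  T (((x <ᵇ n) ∧ (y <ᵇ n)) ∨ ((x ≡ᵇ n) ∧ (y ≡ᵇ 0))) ⇔ LollipopEdge n x y
lollipopEdge⇔ n x y =
  ⇔-trans T-∨ (⇔-trans T-∧ (<ᵇ⇔< ×-⇔ <ᵇ⇔<) ⊎-⇔ ⇔-trans T-∧ (≡ᵇ⇔≡ ×-⇔ ≡ᵇ⇔≡))
  where
  <ᵇ⇔< : ∀ {a b} → T (a <ᵇ b) ⇔ (a < b)
  <ᵇ⇔< = mk⇔ (<ᵇ⇒< _ _) <⇒<ᵇ
  ≡ᵇ⇔≡ : ∀ {a b} → T (a ≡ᵇ b) ⇔ (a ≡ b)
  ≡ᵇ⇔≡ = mk⇔ (≡ᵇ⇒≡ _ _) (≡⇒≡ᵇ _ _)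

adj-lollipop : ∀ {n} (u v : Fin (suc n)) → T (adj (lollipop n) u v) ⇔
  (u ≢ v × (LollipopEdge n (toℕ u) (toℕ v) ⊎ LollipopEdge n (toℕ v) (toℕ u)))
adj-lollipop {n} u v = ⇔-trans
  (adj-symClosure (λ u v → ((toℕ u <ᵇ n) ∧ (toℕ v <ᵇ n)) ∨ ((toℕ u ≡ᵇ n) ∧ (toℕ v ≡ᵇ 0))) u v)
  (⇔-refl ×-⇔ (lollipopEdge⇔ n _ _ ⊎-⇔ lollipopEdge⇔ n _ _))

below-or-top : ∀ {n} (x : Fin (suc n)) → toℕ x < n ⊎ toℕ x ≡ n
below-or-top x = m≤n⇒m<n∨m≡n (toℕ≤pred[n] x)

lollipop-clique : ∀ {n} {u v : Fin (suc n)} → toℕ u < n → toℕ v < n → u ≢ v →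
  T (adj (lollipop n) u v)
lollipop-clique {u = u} {v} u<n v<n u≢v =
  from (adj-lollipop u v) (u≢v , inj₁ (inj₁ (u<n , v<n)))

lollipop-pendant-only : ∀ {n} {u : Fin (suc n)} → T (adj (lollipop n) u (fromℕ n)) → u ≡ zero
lollipop-pendant-only {n} {u} a
  with u≢top , e ← to (adj-lollipop u (fromℕ n)) a
  with subst (λ y → LollipopEdge n (toℕ u) y ⊎ LollipopEdge n y (toℕ u)) (toℕ-fromℕ n) e
... | inj₁ (inj₁ (_ , n<n)) = ⊥-elim (<-irrefl refl n<n)
... | inj₁ (inj₂ (u≡n , _)) = ⊥-elim (u≢top (toℕ-injective (trans u≡n (≡.sym (toℕ-fromℕ n)))))
... | inj₂ (inj₁ (n<n , _)) = ⊥-elim (<-irrefl refl n<n)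
... | inj₂ (inj₂ (_ , u≡0))  = toℕ-injective u≡0

lollipop-pendantHub : ∀ n → PendantHub (lollipop (suc n)) zero
lollipop-pendantHub n .hub-adj {zero} 0≢0 = ⊥-elim (0≢0 refl)
lollipop-pendantHub n .hub-adj {v@(suc _)} v≢0 with below-or-top v
... | inj₁ v<n = lollipop-clique (s≤s z≤n) v<n (≢-sym v≢0)
... | inj₂ v≡n = from (adj-lollipop zero v) (≢-sym v≢0 , inj₂ (inj₂ (v≡n , refl)))
lollipop-pendantHub n .pendant = fromℕ (suc n)
lollipop-pendantHub n .pendant-only = lollipop-pendant-only

deleteEdge-adj⇒ : ∀ G {a b u v} → T (adj (deleteEdge G a b) u v) → T (adj G u v)
deleteEdge-adj⇒ G = proj₁ ∘ to T-∧

deleteEdge-adj-away : ∀ G {a b u} → u ≢ a → u ≢ b → ∀ v → adj (deleteEdge G a b) u v ≡ adj G u v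
deleteEdge-adj-away G {a} {b} {u} u≢a u≢b v = begin
  adj G u v ∧ not (((toℕ u ≡ᵇ toℕ a) ∧ (toℕ v ≡ᵇ toℕ b)) ∨ ((toℕ v ≡ᵇ toℕ a) ∧ (toℕ u ≡ᵇ toℕ b)))
    ≡⟨ cong₂ (λ x y → adj G u v ∧ not ((x ∧ (toℕ v ≡ᵇ toℕ b)) ∨ ((toℕ v ≡ᵇ toℕ a) ∧ y)))
             (≢⇒≡ᵇ≡false u≢a) (≢⇒≡ᵇ≡false u≢b) ⟩
  adj G u v ∧ not ((toℕ v ≡ᵇ toℕ a) ∧ false)
    ≡⟨ cong (λ x → adj G u v ∧ not x) (∧-zeroʳ _) ⟩
  adj G u v ∧ true
    ≡⟨ ∧-identityʳ _ ⟩
  adj G u v ∎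
  where open ≡-Reasoning

pendantHub-deleteEdge : ∀ {G h a b} → PendantHub G h → h ≢ a → h ≢ b →
  PendantHub (deleteEdge G a b) h
pendantHub-deleteEdge {G} P h≢a h≢b .hub-adj {v} v≢h =
  subst T (≡.sym (deleteEdge-adj-away G h≢a h≢b v)) (hub-adj P v≢h)
pendantHub-deleteEdge P h≢a h≢b .pendant = pendant P
pendantHub-deleteEdge {G} P h≢a h≢b .pendant-only = pendant-only P ∘ deleteEdge-adj⇒ G

star~tlollipop : ∀ n → star (suc n) ~t lollipop (suc n)
star~tlollipop n = countOfSize-cong λ D →
  ⇔-trans (isTotalDominating⇔HubAndAnother (star-pendantHub n) D)
          (⇔-sym (isTotalDominating⇔HubAndAnother (lollipop-pendantHub n) D))

star~tlollipop-edge : ∀ n {a b : Fin (suc (suc n))} → zero ≢ a → zero ≢ b →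
  star (suc n) ~t deleteEdge (lollipop (suc n)) a b
star~tlollipop-edge n 0≢a 0≢b = countOfSize-cong λ D →
  ⇔-trans (isTotalDominating⇔HubAndAnother (star-pendantHub n) D)
          (⇔-sym (isTotalDominating⇔HubAndAnother
                   (pendantHub-deleteEdge (lollipop-pendantHub n) 0≢a 0≢b) D))

record IndependentTriple (G : Graph) : Set where
  field
    x y z : Fin (order G)
    x≢y : x ≢ y
    x≢z : x ≢ z
    y≢z : y ≢ z
    x≁y : ¬ T (adj G x y)
    x≁z : ¬ T (adj G x z)
    y≁z : ¬ T (adj G y z)

≅-independentTriple : ∀ {G H} → G ≅ H → IndependentTriple G → IndependentTriple H
≅-independentTriple (f , adj-preserved) t = record
  { x = to′ x ; y = to′ y ; z = to′ z
  ; x≢y = x≢y ∘ injective ; x≢z = x≢z ∘ injective ; y≢z = y≢z ∘ injective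
  ; x≁y = x≁y ∘ subst T (≡.sym (adj-preserved x y))
  ; x≁z = x≁z ∘ subst T (≡.sym (adj-preserved x z))
  ; y≁z = y≁z ∘ subst T (≡.sym (adj-preserved y z))
  }
  where
  open IndependentTriple t
  open Bijection f using (injective) renaming (to to to′)

star-independentTriple : ∀ m → IndependentTriple (star (3 + m))
star-independentTriple m = record
  { x = suc zero ; y = suc (suc zero) ; z = suc (suc (suc zero))
  ; x≢y = λ () ; x≢z = λ () ; y≢z = λ ()
  ; x≁y = star-leaves-nonadjacent {3 + m} zero (suc zero)
  ; x≁z = star-leaves-nonadjacent {3 + m} zero (suc (suc zero))
  ; y≁z = star-leaves-nonadjacent {3 + m} (suc zero) (suc (suc zero))
  }

-- Of three distinct vertices at most one is the pendant vertex, so two lie in the clique.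
lollipop-noIndependentTriple : ∀ {n} → ¬ IndependentTriple (lollipop n)
lollipop-noIndependentTriple record
  { x = x ; y = y ; z = z ; x≢y = x≢y ; x≢z = x≢z ; y≢z = y≢z ; x≁y = x≁y ; x≁z = x≁z ; y≁z = y≁z }
  with below-or-top x | below-or-top y | below-or-top z
... | inj₁ x<n | inj₁ y<n | _        = x≁y (lollipop-clique x<n y<n x≢y)
... | inj₁ x<n | _        | inj₁ z<n = x≁z (lollipop-clique x<n z<n x≢z)
... | _        | inj₁ y<n | inj₁ z<n = y≁z (lollipop-clique y<n z<n y≢z)
... | inj₂ x≡n | inj₂ y≡n | _        = x≢y (toℕ-injective (trans x≡n (≡.sym y≡n)))
... | inj₂ x≡n | _        | inj₂ z≡n = x≢z (toℕ-injective (trans x≡n (≡.sym z≡n)))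
... | _        | inj₂ y≡n | inj₂ z≡n = y≢z (toℕ-injective (trans y≡n (≡.sym z≡n)))

star-not-DtUnique : ∀ m → ¬ DtUnique (star (3 + m))
star-not-DtUnique m unique =
  lollipop-noIndependentTriple
    (≅-independentTriple (unique (lollipop (3 + m)) (star~tlollipop (2 + m)))
                         (star-independentTriple m))

positive⇒zero≢ : ∀ {n} {a : Fin (suc n)} → 1 ≤ toℕ a → zero ≢ a
positive⇒zero≢ {a = suc _} _ ()

-- The deleted edge only has to avoid vertex 0.
mainTheorem5 : (n : ℕ) → 2 < n →
    ¬ DtUnique (star n)
    × star n ~t lollipop n
    × ((a b : Fin (suc n)) → 1 ≤ toℕ a → toℕ a < n → 1 ≤ toℕ b → toℕ b < n → a ≢ b →
        star n ~t deleteEdge (lollipop n) a b)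
mainTheorem5 (suc (suc (suc m))) _ =
  star-not-DtUnique m ,
  star~tlollipop (2 + m) ,
  λ a b 1≤a _ 1≤b _ _ → star~tlollipop-edge (2 + m) (positive⇒zero≢ 1≤a) (positive⇒zero≢ 1≤b)
mainTheorem5 0 ()
mainTheorem5 1 (s≤s ())
mainTheorem5 2 (s≤s (s≤s ()))
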